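{- Let $r\in\{\beta,\beta\eta,h\}$, let $M:\langle(x_j^{L_j}:U_j)_{1\le j\le n}\vdash U\rangle$ be derivable, let $\mathcal I$ be an $r$-interpretation, and for all $j\in\{1,\dots,n\}$ let $N_j\in\mathcal I(U_j)$. If $M[(x_j^{L_j}:=N_j)_n]\in\mathcal M$ then $M[(x_j^{L_j}:=N_j)_n]\in\mathcal I(U)$.
   Context: Indexes: an index is a finite sequence of natural numbers; $\mathcal L_{\mathbb N}$ is the set of indexes, $\oslash$ the empty sequence, $i::L$ prepending $i$, $L::K$ concatenation; $L_1\preceq L_2$ (also $L_2\succeq L_1$) iff $L_2=L_1::L_3$ for some $L_3$. Terms: $\mathcal V$ is a countably infinite set of variables. Terms $\mathcal M$, free indexed variables $\mathrm{fv}$, degree $d$ and joinability $\diamond$ are defined simultaneously: $x^L\in\mathcal M$, $\mathrm{fv}(x^L)=\{x^L\}$, $d(x^L)=L$; if $M,N\in\mathcal M$, $d(M)\preceq d(N)$ and $M\diamond N$ then $MN\in\mathcal M$, $\mathrm{fv}(MN)=\mathrm{fv}(M)\cup\mathrm{fv}(N)$, $d(MN)=d(M)$; if $L\succeq d(M)$ then $\lambda x^L.M\in\mathcal M$, $\mathrm{fv}=\mathrm{fv}(M)\setminus\{x^L\}$, $d(\lambda x^L.M)=d(M)$. $M\diamond N$ iff $x^L\in\mathrm{fv}(M)$ and $x^K\in\mathrm{fv}(N)$ imply $L=K$. Terms are modulo $\alpha$-conversion. Simultaneous substitution $M[(x_i^{L_i}:=N_i)_n]$ (capture-avoiding) is defined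 only when $M,N_1,\dots,N_n$ are pairwise joinable and $d(N_i)=L_i$; "$\in\mathcal M$" expresses that it is defined and is a term. $\rhd_\beta$: least relation compatible with abstraction and application containing $(\lambda x^L.M)N\rhd_\beta M[x^L:=N]$ for $d(N)=L$; $\rhd_\eta$ from $\lambda x^L.(Mx^L)\rhd_\eta M$ for $x^L\notin\mathrm{fv}(M)$; $\rhd_{\beta\eta}=\rhd_\beta\cup\rhd_\eta$; $(\lambda x^L.M)NN_1\dots N_n\rhd_h M[x^L:=N]N_1\dots N_n$; $\rhd_r^*$ reflexive–transitive closure. Lifting: $(x^L)^{+i}=x^{i::L}$, $(M_1M_2)^{+i}=M_1^{+i}M_2^{+i}$, $(\lambda x^L.M)^{+i}=\lambda x^{i::L}.M^{+i}$. Types: $\mathcal A$ atomic types, $\overline e_0,\overline e_1,\dots$ expansion variables; $\mathbb T\subseteq\mathbb U$ and $d:\mathbb U\to\mathcal L_{\mathbb N}$: $a\in\mathbb T$, $d(a)=\oslash$; $U\in\mathbb U,T\in\mathbb T\Rightarrow U\to T\in\mathbb T$, $d=\oslash$; $\omega^L\in\mathbb U$, $d(\omega^L)=L$; $U_1\sqcap U_2\in\mathbb U$ when $d(U_1)=d(U_2)$, same degree; $\overline e_iU\in\mathbb U$, $d=i::d(U)$. Quotient: $\sqcap$ commutative, associative, idempotent; $\overline e_i(U_1\sqcap U_2)=\overline e_iU_1\sqcap\overline e_iU_2$; $\omega^L\sqcap U=U$ for $d(U)=L$; $\overline e_i\omega^K=\omega^{i::K}$. Environments: finite sets $\{x_1^{L_1}:U_1,\dots\}$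 giving each $x^L$ at most one type; $()$ empty; $\Gamma,\Delta$ disjoint union; $env^\omega_M$ assigns $\omega^L$ to each $x^L\in\mathrm{fv}(M)$; $\Gamma_1\sqcap\Gamma_2$ intersects the types of common variables and keeps others; $\overline e_j\{x_i^{L_i}:U_i\}=\{x_i^{j::L_i}:\overline e_jU_i\}$; $\Gamma_1\diamond\Gamma_2$ iff $x^L\in\mathrm{dom}\,\Gamma_1$, $x^K\in\mathrm{dom}\,\Gamma_2$ imply $L=K$. Subtyping $\sqsubseteq$ is the least relation on types, environments and typings closed under: reflexivity; transitivity; $U_1\sqcap U_2\sqsubseteq U_1$ if $d(U_1)=d(U_2)$; $U_1\sqcap U_2\sqsubseteq V_1\sqcap V_2$ if $U_i\sqsubseteq V_i$; $U_1\to T_1\sqsubseteq U_2\to T_2$ if $U_2\sqsubseteq U_1$, $T_1\sqsubseteq T_2$; $\overline e_iU_1\sqsubseteq\overline e_iU_2$ if $U_1\sqsubseteq U_2$; $\Gamma,y^L:U_1\sqsubseteq\Gamma,y^L:U_2$ if $U_1\sqsubseteq U_2$; $\langle\Gamma_1\vdash U_1\rangle\sqsubseteq\langle\Gamma_2\vdash U_2\rangle$ if $U_1\sqsubseteq U_2$, $\Gamma_2\sqsubseteq\Gamma_1$. Typing rules ($T\in\mathbb T$): (ax) $x^\oslash:\langle(x^\oslash:T)\vdash T\rangle$; ($\omega$) $M:\langle env^\omega_M\vdash\omega^{d(M)}\rangle$; ($\to_I$) $M:\langle\Gamma,(x^L:U)\vdash T\rangle\Rightarrow\lambda x^L.M:\langle\Gamma\vdash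 U\to T\rangle$; ($\to_I'$) $M:\langle\Gamma\vdash T\rangle$, $x^L\notin\mathrm{dom}\,\Gamma\Rightarrow\lambda x^L.M:\langle\Gamma\vdash\omega^L\to T\rangle$; ($\to_E$) $M_1:\langle\Gamma_1\vdash U\to T\rangle$, $M_2:\langle\Gamma_2\vdash U\rangle$, $\Gamma_1\diamond\Gamma_2\Rightarrow M_1M_2:\langle\Gamma_1\sqcap\Gamma_2\vdash T\rangle$; ($\sqcap_I$) $M:\langle\Gamma\vdash U_1\rangle$, $M:\langle\Gamma\vdash U_2\rangle\Rightarrow M:\langle\Gamma\vdash U_1\sqcap U_2\rangle$; ($e$) $M:\langle\Gamma\vdash U\rangle\Rightarrow M^{+j}:\langle\overline e_j\Gamma\vdash\overline e_jU\rangle$; ($\sqsubseteq$) $M:\langle\Gamma\vdash U\rangle$, $\langle\Gamma\vdash U\rangle\sqsubseteq\langle\Gamma'\vdash U'\rangle\Rightarrow M:\langle\Gamma'\vdash U'\rangle$. Realisability: $\mathcal V=\mathcal V_1\cup\mathcal V_2$, disjoint countably infinite. For $\mathcal X,\mathcal Y\subseteq\mathcal M$: $\mathcal X^{+i}=\{M^{+i}:M\in\mathcal X\}$; $\mathcal X\leadsto\mathcal Y=\{M\in\mathcal M: MN\in\mathcal Y$ for all $N\in\mathcal X$ with $M\diamond N\}$; $\mathcal X$ is $r$-saturated if $M\rhd_r^*N$, $N\in\mathcal X$ imply $M\in\mathcal X$. $\mathcal M^L=\{M:d(M)=L\}$; for $x\in\mathcal V_1$, $\mathcal N^L_x=\{x^LN_1\dots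 N_k\in\mathcal M:k\ge0\}$. An $r$-interpretation is $\mathcal I:\mathcal A\to\mathcal P(\mathcal M^\oslash)$ with each $\mathcal I(a)$ $r$-saturated and containing $\mathcal N^\oslash_x$ for all $x\in\mathcal V_1$, extended by $\mathcal I(\omega^L)=\mathcal M^L$, $\mathcal I(\overline e_iU)=\mathcal I(U)^{+i}$, $\mathcal I(U_1\sqcap U_2)=\mathcal I(U_1)\cap\mathcal I(U_2)$, $\mathcal I(U\to T)=\mathcal I(U)\leadsto\mathcal I(T)$. -}

module Defs where

open import Data.Nat using (ℕ; zero; suc; _*_; _<_)
import Data.Nat as ℕ
open import Data.Fin using (Fin; zero; suc)
open import Data.List using (List; []; _∷_; _++_; map)
import Data.List.Properties as LP
open import Data.List.Membership.Propositional using (_∈_; _∉_)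
import Data.List.Membership.DecPropositional as DecMem
open import Data.Maybe using (Maybe; just; nothing; Is-just)
import Data.Maybe as Maybe
open import Data.Maybe.Relation.Binary.Pointwise using (Pointwise)
open import Data.Product using (Σ; ∃; _×_; _,_; proj₁)
import Data.Product.Properties as PP
open import Data.Sum using (_⊎_)
open import Relation.Nullary using (Dec; yes; no; ¬_)
open import Relation.Binary.PropositionalEquality using (_≡_; subst)
open import Relation.Binary.Construct.Closure.ReflexiveTransitive using (Star)
open import Function using (_∘_)

Index : Set
Index = List ℕ

_≟L_ : (K L : Index) → Dec (K ≡ L)
_≟L_ = LP.≡-dec ℕ._≟_

_⪯_ : Index → Index → Set
L₁ ⪯ L₂ = Σ Index λ L₃ → L₂ ≡ L₁ ++ L₃

-- Raw terms, locally nameless representation (canonical for α-classes).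
-- Variables are natural numbers; a free indexed variable x^L is
-- 'fvar x L'; bound variables are de Bruijn indices 'bvar i'; the binder
-- 'lam L b' stands for λ x^L . b (with x^L represented by bvar 0 in b).

data Tm : Set where
  fvar : ℕ → Index → Tm
  bvar : ℕ → Tm
  app  : Tm → Tm → Tm
  lam  : Index → Tm → Tm

fv : Tm → List (ℕ × Index)
fv (fvar x L) = (x , L) ∷ []
fv (bvar i)   = []
fv (app M N)  = fv M ++ fv N
fv (lam L M)  = fv M

names : Tm → List ℕ
names M = map proj₁ (fv M)

_≟V_ : (a b : ℕ × Index) → Dec (a ≡ b)
_≟V_ = PP.≡-dec ℕ._≟_ _≟L_

_∈?fv_ : (a : ℕ × Index) → (M : Tm) → Dec (a ∈ fv M)
a ∈?fv M = DecMem._∈?_ _≟V_ a (fv M)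

lookupIx : List Index → ℕ → Index
lookupIx []       i       = []
lookupIx (L ∷ Γ)  zero    = L
lookupIx (L ∷ Γ)  (suc i) = lookupIx Γ i

degAt : List Index → Tm → Index
degAt Γ (fvar x L) = L
degAt Γ (bvar i)   = lookupIx Γ i
degAt Γ (app M N)  = degAt Γ M
degAt Γ (lam L M)  = degAt (L ∷ Γ) M

deg : Tm → Index
deg = degAt []

Joinable : Tm → Tm → Set
Joinable M N = ∀ x L K → (x , L) ∈ fv M → (x , K) ∈ fv N → L ≡ K

openAt : ℕ → Tm → Tm → Tm
openAt k u (fvar x L) = fvar x L
openAt k u (bvar i) with i ℕ.≟ k
... | yes _ = u
... | no _  = bvar i
openAt k u (app M N) = app (openAt k u M) (openAt k u N)
openAt k u (lam L M) = lam L (openAt (suc k) u M)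

open0 : Tm → Tm → Tm
open0 = openAt 0

closeAt : ℕ → ℕ → Index → Tm → Tm
closeAt k x L (fvar y K) with (y , K) ≟V (x , L)
... | yes _ = bvar k
... | no _  = fvar y K
closeAt k x L (bvar i)  = bvar i
closeAt k x L (app M N) = app (closeAt k x L M) (closeAt k x L N)
closeAt k x L (lam K M) = lam K (closeAt (suc k) x L M)

ƛ : ℕ → Index → Tm → Tm
ƛ x L M = lam L (closeAt 0 x L M)

lcAt : ℕ → Tm → Set
lcAt k (fvar x L) = Data.Unit.⊤ where import Data.Unit
lcAt k (bvar i)   = i < k
lcAt k (app M N)  = lcAt k M × lcAt k N
lcAt k (lam L M)  = lcAt (suc k) M

data IsTerm : Tm → Set where
  var : ∀ x L → IsTerm (fvar x L)
  app : ∀ {M N} → IsTerm M → IsTerm N → deg M ⪯ deg N → Joinable M N →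
        IsTerm (app M N)
  lam : ∀ {L M} (y : ℕ) → y ∉ names M → IsTerm (open0 (fvar y L) M) →
        deg (open0 (fvar y L) M) ⪯ L → IsTerm (lam L M)

lift : ℕ → Tm → Tm
lift i (fvar x L) = fvar x (i ∷ L)
lift i (bvar k)   = bvar k
lift i (app M N)  = app (lift i M) (lift i N)
lift i (lam L M)  = lam (i ∷ L) (lift i M)

findIx : ∀ {n} (xs : Fin n → ℕ) (Ls : Fin n → Index) (x : ℕ) (L : Index) →
         Maybe (Σ (Fin n) λ j → (xs j ≡ x) × (Ls j ≡ L))
findIx {zero}  xs Ls x L = nothing
findIx {suc n} xs Ls x L with xs zero ℕ.≟ x | Ls zero ≟L L
... | yes p | yes q = just (zero , p , q)
... | _     | _     =
  Maybe.map (λ { (j , p , q) → suc j , p , q }) (findIx (xs ∘ suc) (Ls ∘ suc) x L)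

substM : ∀ {n} (xs : Fin n → ℕ) (Ls : Fin n → Index) (Ns : Fin n → Tm) → Tm → Tm
substM xs Ls Ns (fvar y K) = Maybe.maybe (λ { (j , _) → Ns j }) (fvar y K) (findIx xs Ls y K)
substM xs Ls Ns (bvar i)   = bvar i
substM xs Ls Ns (app M N)  = app (substM xs Ls Ns M) (substM xs Ls Ns N)
substM xs Ls Ns (lam L M)  = lam L (substM xs Ls Ns M)

-- "M[(x_j^{L_j} := N_j)_n] ∈ 𝓜": the substitution is defined (M, N_1..N_n
-- pairwise joinable, d(N_j) = L_j) and its result is a term.
SubstInM : ∀ {n} (M : Tm) (xs : Fin n → ℕ) (Ls : Fin n → Index) (Ns : Fin n → Tm) → Set
SubstInM M xs Ls Ns =
  (∀ j → Joinable M (Ns j)) × (∀ j → Joinable (Ns j) M) ×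
  (∀ i j → Joinable (Ns i) (Ns j)) ×
  (∀ j → deg (Ns j) ≡ Ls j) ×
  IsTerm (substM xs Ls Ns M)

data BetaC : Tm → Tm → Set where
  beta : ∀ {L M N} → deg N ≡ L → BetaC (app (lam L M) N) (open0 N M)

-- λx^L.(M x^L) ▷ M  with x^L ∉ fv(M)
data EtaC : Tm → Tm → Set where
  eta : ∀ {L M} → lcAt 0 M → EtaC (lam L (app M (bvar 0))) M

data HeadC : Tm → Tm → Set where
  hbase : ∀ {L M N} → deg N ≡ L → HeadC (app (lam L M) N) (open0 N M)
  happ  : ∀ {M M' P} → HeadC M M' → HeadC (app M P) (app M' P)

data Cl (R : Tm → Tm → Set) : Tm → Tm → Set where
  base : ∀ {M N} → R M N → Cl R M N
  appL : ∀ {M M' N} → Cl R M M' → Cl R (app M N) (app M' N)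
  appR : ∀ {M N N'} → Cl R N N' → Cl R (app M N) (app M N')
  lam  : ∀ {L M P} (y : ℕ) → y ∉ names M → Cl R (open0 (fvar y L) M) P →
         Cl R (lam L M) (ƛ y L P)

data Red : Set where
  rβ rβη rh : Red

Step : Red → Tm → Tm → Set
Step rβ  = Cl BetaC
Step rβη = Cl (λ M N → BetaC M N ⊎ EtaC M N)
Step rh  = HeadC

Steps : Red → Tm → Tm → Set
Steps r = Star (Step r)

-- Types (intrinsically indexed by their degree); atoms are ℕ.

mutual
  data TT : Set where
    atom : ℕ → TT
    _⇒_  : ∀ {L} → UU L → TT → TT

  data UU : Index → Set where
    ⌊_⌋ : TT → UU []
    ω   : (L : Index) → UU L
    _⊓_ : ∀ {L} → UU L → UU L → UU L
    ē   : ∀ {L} (i : ℕ) → UU L → UU (i ∷ L)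

infixr 6 _⊓_
infixr 5 _⇒_

-- the equations defining the quotient of types (congruence closure)
data _≈_ : ∀ {L} → UU L → UU L → Set where
  ≈refl  : ∀ {L} {U : UU L} → U ≈ U
  ≈sym   : ∀ {L} {U V : UU L} → U ≈ V → V ≈ U
  ≈trans : ∀ {L} {U V W : UU L} → U ≈ V → V ≈ W → U ≈ W
  ⊓comm  : ∀ {L} {U V : UU L} → (U ⊓ V) ≈ (V ⊓ U)
  ⊓assoc : ∀ {L} {U V W : UU L} → ((U ⊓ V) ⊓ W) ≈ (U ⊓ (V ⊓ W))
  ⊓idem  : ∀ {L} {U : UU L} → (U ⊓ U) ≈ U
  ē⊓     : ∀ {L} {i} {U V : UU L} → ē i (U ⊓ V) ≈ (ē i U ⊓ ē i V)
  ω⊓     : ∀ {L} {U : UU L} → (ω L ⊓ U) ≈ U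
  ēω     : ∀ {i K} → ē i (ω K) ≈ ω (i ∷ K)
  ⊓cong  : ∀ {L} {U U' V V' : UU L} → U ≈ U' → V ≈ V' → (U ⊓ V) ≈ (U' ⊓ V')
  ēcong  : ∀ {L} {i} {U U' : UU L} → U ≈ U' → ē i U ≈ ē i U'
  ⇒cong  : ∀ {L} {U U' : UU L} {T T'} → U ≈ U' → ⌊ T ⌋ ≈ ⌊ T' ⌋ →
           ⌊ U ⇒ T ⌋ ≈ ⌊ U' ⇒ T' ⌋

data _⊑_ : ∀ {L} → UU L → UU L → Set where
  ⊑≈     : ∀ {L} {U V : UU L} → U ≈ V → U ⊑ V
  ⊑trans : ∀ {L} {U V W : UU L} → U ⊑ V → V ⊑ W → U ⊑ W
  ⊑⊓     : ∀ {L} {U₁ U₂ : UU L} → (U₁ ⊓ U₂) ⊑ U₁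
  ⊑⊓mono : ∀ {L} {U₁ U₂ V₁ V₂ : UU L} → U₁ ⊑ V₁ → U₂ ⊑ V₂ → (U₁ ⊓ U₂) ⊑ (V₁ ⊓ V₂)
  ⊑⇒     : ∀ {L} {U₁ U₂ : UU L} {T₁ T₂} → U₂ ⊑ U₁ → ⌊ T₁ ⌋ ⊑ ⌊ T₂ ⌋ →
           ⌊ U₁ ⇒ T₁ ⌋ ⊑ ⌊ U₂ ⇒ T₂ ⌋
  ⊑ē     : ∀ {L} {i} {U₁ U₂ : UU L} → U₁ ⊑ U₂ → ē i U₁ ⊑ ē i U₂

Env : Set
Env = ℕ → (L : Index) → Maybe (UU L)

emptyEnv : Env
emptyEnv _ _ = nothing

extend : Env → (x : ℕ) (L : Index) → UU L → Env
extend Γ x L U y K with (y , K) ≟V (x , L)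
... | yes p = just (subst UU (Relation.Binary.PropositionalEquality.sym (Relation.Binary.PropositionalEquality.cong Data.Product.proj₂ p)) U)
  where import Relation.Binary.PropositionalEquality
        import Data.Product
... | no _  = Γ y K

envω : Tm → Env
envω M y K with (y , K) ∈?fv M
... | yes _ = just (ω K)
... | no _  = nothing

_⊓E_ : Env → Env → Env
(Γ₁ ⊓E Γ₂) y K with Γ₁ y K | Γ₂ y K
... | just U | just V = just (U ⊓ V)
... | just U | nothing = just U
... | nothing | m = m

ēE : ℕ → Env → Env
ēE j Γ y []      = nothing
ēE j Γ y (i ∷ L) with i ℕ.≟ j
... | yes p = Maybe.map (subst (λ k → UU (k ∷ L)) (Relation.Binary.PropositionalEquality.sym p) ∘ ē j) (Γ y L)
  where import Relation.Binary.PropositionalEquality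
... | no _  = nothing

_⋄E_ : Env → Env → Set
Γ₁ ⋄E Γ₂ = ∀ x L K → Is-just (Γ₁ x L) → Is-just (Γ₂ x K) → L ≡ K

_⊑E_ : Env → Env → Set
Γ ⊑E Δ = ∀ x L → Pointwise (_⊑_ {L}) (Γ x L) (Δ x L)

data _⦂⟨_⊢_⟩ : Tm → Env → ∀ {K} → UU K → Set where
  ax   : ∀ x T → fvar x [] ⦂⟨ extend emptyEnv x [] ⌊ T ⌋ ⊢ ⌊ T ⌋ ⟩
  ωr   : ∀ M → IsTerm M → M ⦂⟨ envω M ⊢ ω (deg M) ⟩
  ⇒I   : ∀ {Γ M x L} {U : UU L} {T} → Γ x L ≡ nothing →
         M ⦂⟨ extend Γ x L U ⊢ ⌊ T ⌋ ⟩ → IsTerm (ƛ x L M) →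
         ƛ x L M ⦂⟨ Γ ⊢ ⌊ U ⇒ T ⌋ ⟩
  ⇒I'  : ∀ {Γ M x L} {T} → M ⦂⟨ Γ ⊢ ⌊ T ⌋ ⟩ → Γ x L ≡ nothing →
         IsTerm (ƛ x L M) → ƛ x L M ⦂⟨ Γ ⊢ ⌊ ω L ⇒ T ⌋ ⟩
  ⇒E   : ∀ {Γ₁ Γ₂ M₁ M₂ L} {U : UU L} {T} → M₁ ⦂⟨ Γ₁ ⊢ ⌊ U ⇒ T ⌋ ⟩ →
         M₂ ⦂⟨ Γ₂ ⊢ U ⟩ → Γ₁ ⋄E Γ₂ → IsTerm (app M₁ M₂) →
         app M₁ M₂ ⦂⟨ Γ₁ ⊓E Γ₂ ⊢ ⌊ T ⌋ ⟩
  ⊓I   : ∀ {Γ M K} {U₁ U₂ : UU K} → M ⦂⟨ Γ ⊢ U₁ ⟩ → M ⦂⟨ Γ ⊢ U₂ ⟩ →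
         M ⦂⟨ Γ ⊢ U₁ ⊓ U₂ ⟩
  er   : ∀ {Γ M K} {U : UU K} j → M ⦂⟨ Γ ⊢ U ⟩ → lift j M ⦂⟨ ēE j Γ ⊢ ē j U ⟩
  ⊑r   : ∀ {Γ Γ' M K} {U U' : UU K} → M ⦂⟨ Γ ⊢ U ⟩ → U ⊑ U' → Γ' ⊑E Γ →
         M ⦂⟨ Γ' ⊢ U' ⟩

envOf : ∀ {n} (xs : Fin n → ℕ) (Ls : Fin n → Index) (Us : (j : Fin n) → UU (Ls j)) → Env
envOf xs Ls Us x L = Maybe.map (λ { (j , _ , q) → subst UU q (Us j) }) (findIx xs Ls x L)

Distinct : ∀ {n} (xs : Fin n → ℕ) (Ls : Fin n → Index) → Set
Distinct xs Ls = ∀ i j → xs i ≡ xs j → Ls i ≡ Ls j → i ≡ j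

-- 𝒱 = 𝒱₁ ∪ 𝒱₂ : 𝒱₁ = even variable names, 𝒱₂ = odd ones
V₁ : ℕ → Set
V₁ x = Σ ℕ λ k → x ≡ 2 * k

TmSet : Set₁
TmSet = Tm → Set

𝓜^ : Index → TmSet
𝓜^ L M = IsTerm M × deg M ≡ L

data Spine (x : ℕ) (L : Index) : Tm → Set where
  hd  : Spine x L (fvar x L)
  _·_ : ∀ {M} → Spine x L M → (N : Tm) → Spine x L (app M N)

𝓝 : Index → ℕ → TmSet
𝓝 L x M = IsTerm M × Spine x L M

Saturated : Red → TmSet → Set
Saturated r X = ∀ M N → IsTerm M → Steps r M N → X N → X M

record Interp (r : Red) : Set₁ where
  field
    ⟪_⟫   : ℕ → TmSet
    ⊆𝓜    : ∀ a M → ⟪ a ⟫ M → 𝓜^ [] M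
    sat   : ∀ a → Saturated r ⟪ a ⟫
    neut  : ∀ a x → V₁ x → ∀ M → 𝓝 [] x M → ⟪ a ⟫ M

_⁺_ : TmSet → ℕ → TmSet
(X ⁺ i) M = Σ Tm λ M' → X M' × M ≡ lift i M'

_⇝_ : TmSet → TmSet → TmSet
(X ⇝ Y) M = IsTerm M × (∀ N → X N → Joinable M N → Y (app M N))

mutual
  ⟦_⟧T : ∀ {r} → TT → Interp r → TmSet
  ⟦ atom a ⟧T I = Interp.⟪_⟫ I a
  ⟦ U ⇒ T ⟧T I = ⟦ U ⟧ I ⇝ ⟦ T ⟧T I

  ⟦_⟧ : ∀ {r L} → UU L → Interp r → TmSet
  ⟦ ⌊ T ⌋ ⟧ I = ⟦ T ⟧T I
  ⟦ ω L ⟧ I = 𝓜^ L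
  ⟦ U ⊓ V ⟧ I = λ M → ⟦ U ⟧ I M × ⟦ V ⟧ I M
  ⟦ ē i U ⟧ I = ⟦ U ⟧ I ⁺ i

module Submission where

-- The substitution is generalised to any partial map σ from indexed variables
-- to terms and the claim is proved by induction on the typing derivation,
-- under the invariant "σ realises Γ" (σ(x^L) ∈ 𝓘(Γ(x^L)) where Γ is defined,
-- σ(x^L) ∈ 𝓜^L elsewhere).  It then shows
-- that each 𝓘(U) contains the variables of 𝒱₁, lies inside 𝓜^{d(U)}, respects
-- ≈ and ⊑, and is closed under head expansion; these give the abstraction
-- case (with saturation), while the expansion case uses that substitution
-- commutes with lifting.  Lemma 11 is the instance σ = (x_j^{L_j} ↦ N_j)_j.

open import Defs
open import Data.Nat using (ℕ; zero; suc; _≤_; _<_; z≤n; s≤s; _+_; _*_)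
import Data.Nat as ℕ
import Data.Nat.Properties as ℕP
open import Data.Nat.ListAction using (sum)
open import Data.List using (List; []; _∷_; _++_; map; length)
import Data.List.Properties as LP
open import Data.List.Membership.Propositional using (_∈_; _∉_)
open import Data.List.Membership.Propositional.Properties using (∈-++⁺ˡ; ∈-++⁺ʳ; ∈-++⁻; ∈-map⁺; ∈-map⁻)
open import Data.List.Relation.Unary.Any using (here; there)
open import Data.Maybe using (Maybe; just; nothing; fromMaybe)
import Data.Maybe as Maybe
open import Data.Maybe.Relation.Unary.All using (All; just; nothing)
open import Data.Maybe.Relation.Binary.Pointwise using (just; nothing)
open import Data.Product using (Σ; _×_; _,_; proj₁; proj₂)
open import Data.Sum using (_⊎_; inj₁; inj₂; map₁)
open import Data.Empty using (⊥; ⊥-elim)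
open import Data.Unit using (⊤; tt)
open import Data.Fin using (Fin)
open import Function using (_∘_)
open import Relation.Nullary using (yes; no)
open import Relation.Binary.PropositionalEquality using (_≡_; _≢_; refl; sym; trans; cong; cong₂; subst; subst₂; module ≡-Reasoning)
open import Relation.Binary.Construct.Closure.ReflexiveTransitive using (ε; _◅_)

tailIx : Index → Index
tailIx []      = []
tailIx (_ ∷ L) = L

⪯-trans : ∀ {L₁ L₂ L₃} → L₁ ⪯ L₂ → L₂ ⪯ L₃ → L₁ ⪯ L₃
⪯-trans {L₁} (K , refl) (K' , refl) = K ++ K' , LP.++-assoc L₁ K K'

[]⪯ : ∀ L → [] ⪯ L
[]⪯ L = L , refl

⪯-∷⁺ : ∀ j {L K} → L ⪯ K → (j ∷ L) ⪯ (j ∷ K)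
⪯-∷⁺ j (L' , p) = L' , cong (j ∷_) p

⪯-∷⁻ : ∀ j {L K} → (j ∷ L) ⪯ (j ∷ K) → L ⪯ K
⪯-∷⁻ j (L' , p) = L' , cong tailIx p

∈⇒≤sum : ∀ {x} xs → x ∈ xs → x ≤ sum xs
∈⇒≤sum (x ∷ xs) (here refl) = ℕP.m≤m+n x (sum xs)
∈⇒≤sum (x ∷ xs) (there m)   = ℕP.≤-trans (∈⇒≤sum xs m) (ℕP.m≤n+m (sum xs) x)

fresh : List ℕ → ℕ
fresh xs = 2 * suc (sum xs)

fresh-V₁ : ∀ xs → V₁ (fresh xs)
fresh-V₁ xs = suc (sum xs) , refl

fresh-∉ : ∀ xs → fresh xs ∉ xs
fresh-∉ xs m = ℕP.<-irrefl refl (ℕP.≤-trans sum<fresh (∈⇒≤sum xs m))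
  where
  sum<fresh : sum xs < fresh xs
  sum<fresh = ℕP.m≤m+n (suc (sum xs)) (suc (sum xs) + 0)

-- Size of a term; it bounds the induction proving that substitution preserves
-- termhood, where bodies are renamed before the induction hypothesis applies.

size : Tm → ℕ
size (fvar _ _) = 1
size (bvar _)   = 1
size (app M N)  = suc (size M + size N)
size (lam _ M)  = suc (size M)

names⁺ : ∀ {y K} M → (y , K) ∈ fv M → y ∈ names M
names⁺ M m = ∈-map⁺ proj₁ m

names⁻ : ∀ {y} M → y ∈ names M → Σ Index λ K → (y , K) ∈ fv M
names⁻ M m with ∈-map⁻ proj₁ m
... | (_ , K) , m' , refl = K , m'

fv-open⁻ : ∀ k u B {a} → a ∈ fv (openAt k u B) → a ∈ fv B ⊎ a ∈ fv u
fv-open⁻ k u (fvar x L) m = inj₁ m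
fv-open⁻ k u (bvar i) m with i ℕ.≟ k
... | yes _ = inj₂ m
fv-open⁻ k u (bvar i) () | no _
fv-open⁻ k u (app M N) m with ∈-++⁻ (fv (openAt k u M)) m
... | inj₁ mM = map₁ ∈-++⁺ˡ (fv-open⁻ k u M mM)
... | inj₂ mN = map₁ (∈-++⁺ʳ (fv M)) (fv-open⁻ k u N mN)
fv-open⁻ k u (lam L M) m = fv-open⁻ (suc k) u M m

fv-open⁺ : ∀ k u B {a} → a ∈ fv B → a ∈ fv (openAt k u B)
fv-open⁺ k u (fvar x L) m = m
fv-open⁺ k u (bvar i) ()
fv-open⁺ k u (app M N) m with ∈-++⁻ (fv M) m
... | inj₁ mM = ∈-++⁺ˡ (fv-open⁺ k u M mM)
... | inj₂ mN = ∈-++⁺ʳ (fv (openAt k u M)) (fv-open⁺ k u N mN)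
fv-open⁺ k u (lam L M) m = fv-open⁺ (suc k) u M m

size-open-fvar : ∀ k y L M → size (openAt k (fvar y L) M) ≡ size M
size-open-fvar k y L (fvar _ _) = refl
size-open-fvar k y L (bvar i) with i ℕ.≟ k
... | yes _ = refl
... | no _  = refl
size-open-fvar k y L (app M N) =
  cong₂ (λ a b → suc (a + b)) (size-open-fvar k y L M) (size-open-fvar k y L N)
size-open-fvar k y L (lam K M) = cong suc (size-open-fvar (suc k) y L M)

openAt-self : ∀ k u → openAt k u (bvar k) ≡ u
openAt-self k u with k ℕ.≟ k
... | yes _ = refl
... | no k≢k = ⊥-elim (k≢k refl)

lc-open : ∀ k u M → lcAt k (openAt k u M) → lcAt (suc k) M
lc-open k u (fvar x L) h = tt
lc-open k u (bvar i) h with i ℕ.≟ k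
... | yes refl = ℕP.n<1+n k
... | no _     = ℕP.m<n⇒m<1+n h
lc-open k u (app M N) (hM , hN) = lc-open k u M hM , lc-open k u N hN
lc-open k u (lam L M) h = lc-open (suc k) u M h

IsTerm⇒lc : ∀ {M} → IsTerm M → lcAt 0 M
IsTerm⇒lc (var x L)                = tt
IsTerm⇒lc (app tM tN _ _)          = IsTerm⇒lc tM , IsTerm⇒lc tN
IsTerm⇒lc (lam {L} {M} y _ tB _)   = lc-open 0 (fvar y L) M (IsTerm⇒lc tB)

open-lc : ∀ {m k} u M → lcAt m M → m ≤ k → openAt k u M ≡ M
open-lc u (fvar x L) h m≤k = refl
open-lc {m} {k} u (bvar i) h m≤k with i ℕ.≟ k
... | yes refl = ⊥-elim (ℕP.<-irrefl refl (ℕP.<-≤-trans h m≤k))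
... | no _     = refl
open-lc u (app M N) (hM , hN) m≤k = cong₂ app (open-lc u M hM m≤k) (open-lc u N hN m≤k)
open-lc u (lam L M) h m≤k = cong (lam L) (open-lc u M h (s≤s m≤k))

lookupIx-prefix : ∀ Δ Γ Γ' i → i < length Δ → lookupIx (Δ ++ Γ) i ≡ lookupIx (Δ ++ Γ') i
lookupIx-prefix (L ∷ Δ) Γ Γ' zero    _       = refl
lookupIx-prefix (L ∷ Δ) Γ Γ' (suc i) (s≤s h) = lookupIx-prefix Δ Γ Γ' i h

degAt-ctx : ∀ Δ Γ Γ' M → lcAt (length Δ) M → degAt (Δ ++ Γ) M ≡ degAt (Δ ++ Γ') M
degAt-ctx Δ Γ Γ' (fvar x L) h = refl
degAt-ctx Δ Γ Γ' (bvar i) h = lookupIx-prefix Δ Γ Γ' i h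
degAt-ctx Δ Γ Γ' (app M N) (hM , _) = degAt-ctx Δ Γ Γ' M hM
degAt-ctx Δ Γ Γ' (lam L M) h = degAt-ctx (L ∷ Δ) Γ Γ' M h

degAt-lc : ∀ Γ M → lcAt 0 M → degAt Γ M ≡ deg M
degAt-lc Γ M h = degAt-ctx [] Γ [] M h

lookupIx-last : ∀ Δ L → lookupIx (Δ ++ L ∷ []) (length Δ) ≡ L
lookupIx-last []      L = refl
lookupIx-last (_ ∷ Δ) L = lookupIx-last Δ L

lookupIx-snoc : ∀ Δ L i → i ≢ length Δ → lookupIx Δ i ≡ lookupIx (Δ ++ L ∷ []) i
lookupIx-snoc []      L zero    i≢ = ⊥-elim (i≢ refl)
lookupIx-snoc []      L (suc i) i≢ = refl
lookupIx-snoc (_ ∷ Δ) L zero    i≢ = refl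
lookupIx-snoc (_ ∷ Δ) L (suc i) i≢ = lookupIx-snoc Δ L i (i≢ ∘ cong suc)

degAt-open : ∀ Δ u B → lcAt 0 u → degAt Δ (openAt (length Δ) u B) ≡ degAt (Δ ++ deg u ∷ []) B
degAt-open Δ u (fvar x L) h = refl
degAt-open Δ u (bvar i) h with i ℕ.≟ length Δ
... | yes refl = trans (degAt-lc Δ u h) (sym (lookupIx-last Δ (deg u)))
... | no i≢    = lookupIx-snoc Δ (deg u) i i≢
degAt-open Δ u (app M N) h = degAt-open Δ u M h
degAt-open Δ u (lam L M) h = degAt-open (L ∷ Δ) u M h

deg-open0 : ∀ u B → lcAt 0 u → deg (open0 u B) ≡ degAt (deg u ∷ []) B
deg-open0 u B h = degAt-open [] u B h

self-joinable : ∀ {M} → IsTerm M → Joinable M M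
self-joinable (var x L) _ _ _ (here refl) (here refl) = refl
self-joinable (app {M} {N} tM tN _ J) x L K m n with ∈-++⁻ (fv M) m | ∈-++⁻ (fv M) n
... | inj₁ mM | inj₁ nM = self-joinable tM x L K mM nM
... | inj₁ mM | inj₂ nN = J x L K mM nN
... | inj₂ mN | inj₁ nM = sym (J x K L nM mN)
... | inj₂ mN | inj₂ nN = self-joinable tN x L K mN nN
self-joinable (lam {L'} {M} y _ tB _) x L K m n =
  self-joinable tB x L K (fv-open⁺ 0 (fvar y L') M m) (fv-open⁺ 0 (fvar y L') M n)

fv-lift⁺ : ∀ j M {x L} → (x , L) ∈ fv M → (x , j ∷ L) ∈ fv (lift j M)
fv-lift⁺ j (fvar y K) (here refl) = here refl
fv-lift⁺ j (bvar i) ()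
fv-lift⁺ j (app M N) m with ∈-++⁻ (fv M) m
... | inj₁ mM = ∈-++⁺ˡ (fv-lift⁺ j M mM)
... | inj₂ mN = ∈-++⁺ʳ (fv (lift j M)) (fv-lift⁺ j N mN)
fv-lift⁺ j (lam L M) m = fv-lift⁺ j M m

fv-lift⁻ : ∀ j M {x L'} → (x , L') ∈ fv (lift j M) →
           Σ Index λ L → L' ≡ j ∷ L × (x , L) ∈ fv M
fv-lift⁻ j (fvar y K) (here refl) = K , refl , here refl
fv-lift⁻ j (bvar i) ()
fv-lift⁻ j (app M N) m with ∈-++⁻ (fv (lift j M)) m
... | inj₁ mM = let (L , e , m') = fv-lift⁻ j M mM in L , e , ∈-++⁺ˡ m'
... | inj₂ mN = let (L , e , m') = fv-lift⁻ j N mN in L , e , ∈-++⁺ʳ (fv M) m'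
fv-lift⁻ j (lam L M) m = fv-lift⁻ j M m

names-lift⁻ : ∀ j M {y} → y ∈ names (lift j M) → y ∈ names M
names-lift⁻ j M m =
  let (K , m') = names⁻ (lift j M) m ; (L , _ , m'') = fv-lift⁻ j M m' in names⁺ M m''

names-lift⁺ : ∀ j M {y} → y ∈ names M → y ∈ names (lift j M)
names-lift⁺ j M m = names⁺ (lift j M) (fv-lift⁺ j M (proj₂ (names⁻ M m)))

lift-open : ∀ j k u M → lift j (openAt k u M) ≡ openAt k (lift j u) (lift j M)
lift-open j k u (fvar x L) = refl
lift-open j k u (bvar i) with i ℕ.≟ k
... | yes _ = refl
... | no _  = refl
lift-open j k u (app M N) = cong₂ app (lift-open j k u M) (lift-open j k u N)
lift-open j k u (lam L M) = cong (lam (j ∷ L)) (lift-open j (suc k) u M)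

lc-lift : ∀ j k M → lcAt k M → lcAt k (lift j M)
lc-lift j k (fvar x L) h = tt
lc-lift j k (bvar i) h = h
lc-lift j k (app M N) (hM , hN) = lc-lift j k M hM , lc-lift j k N hN
lc-lift j k (lam L M) h = lc-lift j (suc k) M h

lookupIx-map : ∀ j Δ i → i < length Δ → lookupIx (map (j ∷_) Δ) i ≡ j ∷ lookupIx Δ i
lookupIx-map j (L ∷ Δ) zero    _       = refl
lookupIx-map j (L ∷ Δ) (suc i) (s≤s h) = lookupIx-map j Δ i h

degAt-lift : ∀ j Δ M → lcAt (length Δ) M → degAt (map (j ∷_) Δ) (lift j M) ≡ j ∷ degAt Δ M
degAt-lift j Δ (fvar x L) h = refl
degAt-lift j Δ (bvar i) h = lookupIx-map j Δ i h
degAt-lift j Δ (app M N) (hM , _) = degAt-lift j Δ M hM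
degAt-lift j Δ (lam L M) h = degAt-lift j (L ∷ Δ) M h

deg-lift : ∀ j M → lcAt 0 M → deg (lift j M) ≡ j ∷ deg M
deg-lift j M h = degAt-lift j [] M h

joinable-lift : ∀ j M N → Joinable M N → Joinable (lift j M) (lift j N)
joinable-lift j M N J x L' K' m n with fv-lift⁻ j M m | fv-lift⁻ j N n
... | L , refl , m' | K , refl , n' = cong (j ∷_) (J x L K m' n')

joinable-unlift : ∀ j M N → Joinable (lift j M) (lift j N) → Joinable M N
joinable-unlift j M N J x L K m n =
  cong tailIx (J x (j ∷ L) (j ∷ K) (fv-lift⁺ j M m) (fv-lift⁺ j N n))

lift-open0 : ∀ j y L M → lift j (open0 (fvar y L) M) ≡ open0 (fvar y (j ∷ L)) (lift j M)
lift-open0 j y L M = lift-open j 0 (fvar y L) M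

IsTerm-lift : ∀ j {M} → IsTerm M → IsTerm (lift j M)
IsTerm-lift j (var x L) = var x (j ∷ L)
IsTerm-lift j (app {M} {N} tM tN d J) =
  app (IsTerm-lift j tM) (IsTerm-lift j tN)
      (subst₂ _⪯_ (sym (deg-lift j M (IsTerm⇒lc tM))) (sym (deg-lift j N (IsTerm⇒lc tN)))
                  (⪯-∷⁺ j d))
      (joinable-lift j M N J)
IsTerm-lift j (lam {L} {M} y y∉M tB d) =
  lam y (y∉M ∘ names-lift⁻ j M) (subst IsTerm (lift-open0 j y L M) (IsTerm-lift j tB)) dB
  where
  dB : deg (open0 (fvar y (j ∷ L)) (lift j M)) ⪯ (j ∷ L)
  dB = subst (_⪯ (j ∷ L))
         (trans (sym (deg-lift j (open0 (fvar y L) M) (IsTerm⇒lc tB))) (cong deg (lift-open0 j y L M)))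
         (⪯-∷⁺ j d)

IsTerm-unlift : ∀ j {P} → IsTerm P → ∀ M → P ≡ lift j M → IsTerm M
IsTerm-unlift j (var x L) (fvar y K) _ = var y K
IsTerm-unlift j (app tP tQ d J) (app M N) refl = app tM tN dMN (joinable-unlift j M N J)
  where
  tM : IsTerm M
  tM = IsTerm-unlift j tP M refl
  tN : IsTerm N
  tN = IsTerm-unlift j tQ N refl
  dMN : deg M ⪯ deg N
  dMN = ⪯-∷⁻ j (subst₂ _⪯_ (deg-lift j M (IsTerm⇒lc tM)) (deg-lift j N (IsTerm⇒lc tN)) d)
IsTerm-unlift j (lam y y∉ tB d) (lam L M) refl = lam y (y∉ ∘ names-lift⁺ j M) tB' dB
  where
  tB' : IsTerm (open0 (fvar y L) M)
  tB' = IsTerm-unlift j tB (open0 (fvar y L) M) (sym (lift-open0 j y L M))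
  dB : deg (open0 (fvar y L) M) ⪯ L
  dB = ⪯-∷⁻ j (subst (_⪯ (j ∷ L))
         (trans (cong deg (sym (lift-open0 j y L M))) (deg-lift j (open0 (fvar y L) M) (IsTerm⇒lc tB'))) d)
IsTerm-unlift j (var _ _)       (bvar _)   ()
IsTerm-unlift j (var _ _)       (app _ _)  ()
IsTerm-unlift j (var _ _)       (lam _ _)  ()
IsTerm-unlift j (app _ _ _ _)   (fvar _ _) ()
IsTerm-unlift j (app _ _ _ _)   (bvar _)   ()
IsTerm-unlift j (app _ _ _ _)   (lam _ _)  ()
IsTerm-unlift j (lam _ _ _ _)   (fvar _ _) ()
IsTerm-unlift j (lam _ _ _ _)   (bvar _)   ()
IsTerm-unlift j (lam _ _ _ _)   (app _ _)  ()

-- It inverts lifting, and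
-- every term of degree j::K is the lift of its unlifting, which is a term of
-- degree K: this is the decomposition  𝓜^{j::K} = (𝓜^K)^{+j}.

unlift : Tm → Tm
unlift (fvar x L) = fvar x (tailIx L)
unlift (bvar i)   = bvar i
unlift (app M N)  = app (unlift M) (unlift N)
unlift (lam L M)  = lam (tailIx L) (unlift M)

unlift-lift : ∀ j M → unlift (lift j M) ≡ M
unlift-lift j (fvar x L) = refl
unlift-lift j (bvar i)   = refl
unlift-lift j (app M N)  = cong₂ app (unlift-lift j M) (unlift-lift j N)
unlift-lift j (lam L M)  = cong (lam L) (unlift-lift j M)

lift-injective : ∀ j M N → lift j M ≡ lift j N → M ≡ N
lift-injective j M N e = trans (sym (unlift-lift j M)) (trans (cong unlift e) (unlift-lift j N))

StartsWith : ℕ → Tm → Set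
StartsWith j (fvar x L) = Σ Index λ L' → L ≡ j ∷ L'
StartsWith j (bvar i)   = ⊤
StartsWith j (app M N)  = StartsWith j M × StartsWith j N
StartsWith j (lam L M)  = (Σ Index λ L' → L ≡ j ∷ L') × StartsWith j M

lift-unlift : ∀ j M → StartsWith j M → lift j (unlift M) ≡ M
lift-unlift j (fvar x _) (_ , refl) = refl
lift-unlift j (bvar i) _ = refl
lift-unlift j (app M N) (sM , sN) = cong₂ app (lift-unlift j M sM) (lift-unlift j N sN)
lift-unlift j (lam _ M) ((L' , refl) , sM) = cong (lam (j ∷ L')) (lift-unlift j M sM)

StartsWith-open : ∀ j k u M → StartsWith j (openAt k u M) → StartsWith j M
StartsWith-open j k u (fvar x L) s = s
StartsWith-open j k u (bvar i) s = tt
StartsWith-open j k u (app M N) (sM , sN) = StartsWith-open j k u M sM , StartsWith-open j k u N sN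
StartsWith-open j k u (lam L M) (sL , sM) = sL , StartsWith-open j (suc k) u M sM

-- In a term, the degree is a prefix of every index (the typing constraints
-- d(M) ⪯ d(N) and d(M) ⪯ L propagate downwards).
StartsWith-term : ∀ j {M} → IsTerm M → (j ∷ []) ⪯ deg M → StartsWith j M
StartsWith-term j (var x L) h = h
StartsWith-term j (app tM tN d _) h = StartsWith-term j tM h , StartsWith-term j tN (⪯-trans h d)
StartsWith-term j (lam {L} {M} y _ tB d) h =
  ⪯-trans h' d , StartsWith-open j 0 (fvar y L) M (StartsWith-term j tB h')
  where
  h' : (j ∷ []) ⪯ deg (open0 (fvar y L) M)
  h' = subst ((j ∷ []) ⪯_) (sym (deg-open0 (fvar y L) M tt)) h

𝓜-unlift : ∀ j K N → 𝓜^ (j ∷ K) N → N ≡ lift j (unlift N) × 𝓜^ K (unlift N)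
𝓜-unlift j K N (tN , dN) =
  N≡ , tN' , cong tailIx (trans (sym (deg-lift j (unlift N) (IsTerm⇒lc tN')))
                                (trans (cong deg (sym N≡)) dN))
  where
  N≡ : N ≡ lift j (unlift N)
  N≡ = sym (lift-unlift j N (StartsWith-term j tN (K , dN)))
  tN' : IsTerm (unlift N)
  tN' = IsTerm-unlift j tN (unlift N) N≡

Sub : Set
Sub = ℕ → Index → Maybe Tm

substS : Sub → Tm → Tm
substS σ (fvar y K) = fromMaybe (fvar y K) (σ y K)
substS σ (bvar i)   = bvar i
substS σ (app M N)  = app (substS σ M) (substS σ N)
substS σ (lam L M)  = lam L (substS σ M)

extendS : Sub → ℕ → Index → Tm → Sub
extendS σ x L N z K with (z , K) ≟V (x , L)
... | yes _ = just N
... | no _  = σ z K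

emptyS : Sub
emptyS _ _ = nothing

single : ℕ → Index → Tm → Sub
single = extendS emptyS

extendS-self : ∀ σ x L N → extendS σ x L N x L ≡ just N
extendS-self σ x L N with (x , L) ≟V (x , L)
... | yes _ = refl
... | no ≢  = ⊥-elim (≢ refl)

single-other : ∀ y L N z K → (z , K) ≢ (y , L) → substS (single y L N) (fvar z K) ≡ fvar z K
single-other y L N z K ≢ with (z , K) ≟V (y , L)
... | yes e = ⊥-elim (≢ e)
... | no _  = refl

WellDegreed : Sub → Set
WellDegreed σ = ∀ y K → All (𝓜^ K) (σ y K)

WellDegreed-extend : ∀ {σ} → WellDegreed σ → ∀ x L N → 𝓜^ L N →
                     WellDegreed (extendS σ x L N)
WellDegreed-extend g x L N h y K with (y , K) ≟V (x , L)
... | yes refl = just h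
... | no _     = g y K

WellDegreed-single : ∀ y L N → 𝓜^ L N → WellDegreed (single y L N)
WellDegreed-single y L N = WellDegreed-extend (λ _ _ → nothing) y L N

-- A well-degreed substitution preserves degrees and commutes with opening
-- (the substituted terms are locally closed).

deg-subst : ∀ {σ} → WellDegreed σ → ∀ Δ M → degAt Δ (substS σ M) ≡ degAt Δ M
deg-subst {σ} g Δ (fvar y K) with σ y K | g y K
... | nothing | _               = refl
... | just P  | just (tP , dP)  = trans (degAt-lc Δ P (IsTerm⇒lc tP)) dP
deg-subst g Δ (bvar i) = refl
deg-subst g Δ (app M N) = deg-subst g Δ M
deg-subst g Δ (lam L M) = deg-subst g (L ∷ Δ) M

subst-open : ∀ {σ} → WellDegreed σ → ∀ k u M →
             substS σ (openAt k u M) ≡ openAt k (substS σ u) (substS σ M)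
subst-open {σ} g k u (fvar y K) with σ y K | g y K
... | nothing | _              = refl
... | just P  | just (tP , _)  = sym (open-lc (substS σ u) P (IsTerm⇒lc tP) z≤n)
subst-open g k u (bvar i) with i ℕ.≟ k
... | yes _ = refl
... | no _  = refl
subst-open g k u (app M N) = cong₂ app (subst-open g k u M) (subst-open g k u N)
subst-open g k u (lam L M) = cong (lam L) (subst-open g (suc k) u M)

-- β-reducing the substituted abstraction σ(λx^L.M) against N gives
-- (σ, x^L ↦ N)(M):  (σ (close x^L M))[0 := N] = (σ, x^L ↦ N) M.
open-subst-close : ∀ {σ} → WellDegreed σ → ∀ k x L N M → lcAt k M →
                   openAt k N (substS σ (closeAt k x L M)) ≡ substS (extendS σ x L N) M
open-subst-close {σ} g k x L N (fvar y K) h with (y , K) ≟V (x , L)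
... | yes _ = openAt-self k N
... | no _ with σ y K | g y K
...   | nothing | _             = refl
...   | just P  | just (tP , _) = open-lc N P (IsTerm⇒lc tP) z≤n
open-subst-close g k x L N (bvar i) h with i ℕ.≟ k
... | yes refl = ⊥-elim (ℕP.<-irrefl refl h)
... | no _     = refl
open-subst-close g k x L N (app M M') (h , h') =
  cong₂ app (open-subst-close g k x L N M h) (open-subst-close g k x L N M' h')
open-subst-close g k x L N (lam K M) h = cong (lam K) (open-subst-close g (suc k) x L N M h)

open-via-single : ∀ k y L N B → (y , L) ∉ fv B →
                  openAt k N B ≡ substS (single y L N) (openAt k (fvar y L) B)
open-via-single k y L N (fvar z K) y∉ with (z , K) ≟V (y , L)
... | yes e = ⊥-elim (y∉ (here (sym e)))
... | no _  = refl
open-via-single k y L N (bvar i) y∉ with i ℕ.≟ k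
... | yes _ rewrite extendS-self emptyS y L N = refl
... | no _  = refl
open-via-single k y L N (app M M') y∉ =
  cong₂ app (open-via-single k y L N M (y∉ ∘ ∈-++⁺ˡ))
            (open-via-single k y L N M' (y∉ ∘ ∈-++⁺ʳ (fv M)))
open-via-single k y L N (lam K M) y∉ = cong (lam K) (open-via-single (suc k) y L N M y∉)

fv-single⁻ : ∀ y L N P {a} → a ∈ fv (substS (single y L N) P) →
             (a ∈ fv P × a ≢ (y , L)) ⊎ a ∈ fv N
fv-single⁻ y L N (fvar z K) m with (z , K) ≟V (y , L)
fv-single⁻ y L N (fvar z K) m           | yes _ = inj₂ m
fv-single⁻ y L N (fvar z K) (here refl) | no ≢  = inj₁ (here refl , ≢)
fv-single⁻ y L N (bvar i) ()
fv-single⁻ y L N (app M M') m with ∈-++⁻ (fv (substS (single y L N) M)) m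
... | inj₁ mM  = map₁ (λ (a , b) → ∈-++⁺ˡ a , b) (fv-single⁻ y L N M mM)
... | inj₂ mM' = map₁ (λ (a , b) → ∈-++⁺ʳ (fv M) a , b) (fv-single⁻ y L N M' mM')
fv-single⁻ y L N (lam K M) m = fv-single⁻ y L N M m

JoinableOutside : Tm → ℕ → Index → Tm → Set
JoinableOutside P y L N =
  ∀ z K K' → (z , K) ∈ fv P → (z , K) ≢ (y , L) → (z , K') ∈ fv N → K ≡ K'

SubstPreservesTerms : ℕ → Set
SubstPreservesTerms n =
  ∀ {P} → IsTerm P → size P ≤ n → ∀ y L N → IsTerm N → deg N ≡ L →
  JoinableOutside P y L N → IsTerm (substS (single y L N) P)

rename-open : ∀ {n L Q} → SubstPreservesTerms n → ∀ y → y ∉ names Q →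
              IsTerm (open0 (fvar y L) Q) → size Q ≤ n →
              ∀ z → z ∉ names Q → IsTerm (open0 (fvar z L) Q)
rename-open {n} {L} {Q} IH y y∉Q tB sQ z z∉Q =
  subst IsTerm (sym (open-via-single 0 y L (fvar z L) Q (y∉Q ∘ names⁺ Q)))
    (IH tB (subst (_≤ n) (sym (size-open-fvar 0 y L Q)) sQ) y L (fvar z L) (var z L) refl jo)
  where
  jo : JoinableOutside (open0 (fvar y L) Q) y L (fvar z L)
  jo w K K' m w≢y (here refl) with fv-open⁻ 0 (fvar y L) Q m
  ... | inj₁ mQ        = ⊥-elim (z∉Q (names⁺ Q mQ))
  ... | inj₂ (here e)  = ⊥-elim (w≢y e)

module _ {n} (IH : SubstPreservesTerms n) (y : ℕ) (L : Index) {N : Tm}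
         (tN : IsTerm N) (dN : deg N ≡ L) where

  private
    g : WellDegreed (single y L N)
    g = WellDegreed-single y L N (tN , dN)

  subst-term-app : ∀ {P Q} → IsTerm P → IsTerm Q → deg P ⪯ deg Q → Joinable P Q →
                   size P + size Q ≤ n → JoinableOutside (app P Q) y L N →
                   IsTerm (substS (single y L N) (app P Q))
  subst-term-app {P} {Q} tP tQ d J sPQ jo =
    app (IH tP (ℕP.m+n≤o⇒m≤o (size P) sPQ) y L N tN dN joP)
        (IH tQ (ℕP.m+n≤o⇒n≤o (size P) sPQ) y L N tN dN joQ)
        (subst₂ _⪯_ (sym (deg-subst g [] P)) (sym (deg-subst g [] Q)) d) J'
    where
    joP : JoinableOutside P y L N
    joP z K K' = jo z K K' ∘ ∈-++⁺ˡ
    joQ : JoinableOutside Q y L N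
    joQ z K K' = jo z K K' ∘ ∈-++⁺ʳ (fv P)
    J' : Joinable (substS (single y L N) P) (substS (single y L N) Q)
    J' x K K' m m' with fv-single⁻ y L N P m | fv-single⁻ y L N Q m'
    ... | inj₁ (mP , _)    | inj₁ (mQ , _)    = J x K K' mP mQ
    ... | inj₁ (mP , x≢y)  | inj₂ mN          = joP x K K' mP x≢y mN
    ... | inj₂ mN          | inj₁ (mQ , x≢y)  = sym (joQ x K' K mQ x≢y mN)
    ... | inj₂ mN          | inj₂ mN'         = self-joinable tN x K K' mN mN'

  -- Abstraction: open the body with a name z fresh for the body, N and y,
  -- rename, and apply the induction hypothesis to the renamed body.
  subst-term-lam : ∀ {L' Q} y' → y' ∉ names Q → IsTerm (open0 (fvar y' L') Q) →
                   deg (open0 (fvar y' L') Q) ⪯ L' → size Q ≤ n →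
                   JoinableOutside Q y L N → IsTerm (substS (single y L N) (lam L' Q))
  subst-term-lam {L'} {Q} y' y'∉Q tB dB sQ jo = lam z z∉σQ (subst IsTerm commute tσB) dσB
    where
    avoid : List ℕ
    avoid = names Q ++ names N ++ y ∷ []
    z : ℕ
    z = fresh avoid
    z∉Q : z ∉ names Q
    z∉Q = fresh-∉ avoid ∘ ∈-++⁺ˡ
    z∉N : z ∉ names N
    z∉N = fresh-∉ avoid ∘ ∈-++⁺ʳ (names Q) ∘ ∈-++⁺ˡ
    z≢y : z ≢ y
    z≢y e = fresh-∉ avoid (∈-++⁺ʳ (names Q) (∈-++⁺ʳ (names N) (here e)))
    σ : Sub
    σ = single y L N
    joB : JoinableOutside (open0 (fvar z L') Q) y L N
    joB w K K' m w≢y mN with fv-open⁻ 0 (fvar z L') Q m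
    ... | inj₁ mQ          = jo w K K' mQ w≢y mN
    ... | inj₂ (here refl) = ⊥-elim (z∉N (names⁺ N mN))
    tσB : IsTerm (substS σ (open0 (fvar z L') Q))
    tσB = IH (rename-open IH y' y'∉Q tB sQ z z∉Q)
             (subst (_≤ n) (sym (size-open-fvar 0 z L' Q)) sQ) y L N tN dN joB
    commute : substS σ (open0 (fvar z L') Q) ≡ open0 (fvar z L') (substS σ Q)
    commute = trans (subst-open g 0 (fvar z L') Q)
                (cong (λ u → open0 u (substS σ Q)) (single-other y L N z L' (z≢y ∘ cong proj₁)))
    z∉σQ : z ∉ names (substS σ Q)
    z∉σQ m with fv-single⁻ y L N Q (proj₂ (names⁻ (substS σ Q) m))
    ... | inj₁ (mQ , _) = z∉Q (names⁺ Q mQ)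
    ... | inj₂ mN       = z∉N (names⁺ N mN)
    dσB : deg (open0 (fvar z L') (substS σ Q)) ⪯ L'
    dσB = subst (_⪯ L') (sym (begin
      deg (open0 (fvar z L') (substS σ Q))  ≡⟨ deg-open0 (fvar z L') (substS σ Q) tt ⟩
      degAt (L' ∷ []) (substS σ Q)          ≡⟨ deg-subst g (L' ∷ []) Q ⟩
      degAt (L' ∷ []) Q                     ≡⟨ deg-open0 (fvar y' L') Q tt ⟨
      deg (open0 (fvar y' L') Q)            ∎)) dB
      where open ≡-Reasoning

subst-preserves-terms : ∀ n → SubstPreservesTerms n
subst-preserves-terms zero (var _ _) ()
subst-preserves-terms zero (app _ _ _ _) ()
subst-preserves-terms zero (lam _ _ _ _) ()
subst-preserves-terms (suc n) (var z K) _ y L N tN dN _ with (z , K) ≟V (y , L)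
... | yes _ = tN
... | no _  = var z K
subst-preserves-terms (suc n) (app tP tQ d J) (s≤s s) y L N tN dN jo =
  subst-term-app (subst-preserves-terms n) y L tN dN tP tQ d J s jo
subst-preserves-terms (suc n) (lam y' y'∉ tB dB) (s≤s s) y L N tN dN jo =
  subst-term-lam (subst-preserves-terms n) y L tN dN y' y'∉ tB dB s jo

single-subst-term : ∀ {P} → IsTerm P → ∀ y L N → IsTerm N → deg N ≡ L →
                    JoinableOutside P y L N → IsTerm (substS (single y L N) P)
single-subst-term {P} tP = subst-preserves-terms (size P) tP ℕP.≤-refl

head⊆step : ∀ r {X Y} → HeadC X Y → Step r X Y
head⊆step rβ  (hbase d) = base (beta d)
head⊆step rβ  (happ h)  = appL (head⊆step rβ h)
head⊆step rβη (hbase d) = base (inj₁ (beta d))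
head⊆step rβη (happ h)  = appL (head⊆step rβη h)
head⊆step rh  h         = h

fv-head : ∀ {X Y a} → HeadC X Y → a ∈ fv Y → a ∈ fv X
fv-head (hbase {L} {B} {N} _) m with fv-open⁻ 0 N B m
... | inj₁ mB = ∈-++⁺ˡ mB
... | inj₂ mN = ∈-++⁺ʳ (fv B) mN
fv-head (happ {M} {M'} h) m with ∈-++⁻ (fv M') m
... | inj₁ mM' = ∈-++⁺ˡ (fv-head h mM')
... | inj₂ mP  = ∈-++⁺ʳ (fv M) mP

deg-head : ∀ {X Y} → lcAt 0 X → HeadC X Y → deg X ≡ deg Y
deg-head (_ , lcN) (hbase {L} {B} {N} dN) rewrite deg-open0 N B lcN | dN = refl
deg-head (lcM , _) (happ h) = deg-head lcM h

deg-spine : ∀ {x M} → Spine x [] M → deg M ≡ []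
deg-spine hd       = refl
deg-spine (sp · N) = deg-spine sp

joinable-fresh : ∀ M x L → x ∉ names M → Joinable M (fvar x L)
joinable-fresh M x L x∉ _ K K' m (here refl) = ⊥-elim (x∉ (names⁺ M m))

typable-lc : ∀ {Γ M K} {U : UU K} → M ⦂⟨ Γ ⊢ U ⟩ → lcAt 0 M
typable-lc (ax x T)          = tt
typable-lc (ωr M tM)         = IsTerm⇒lc tM
typable-lc (⇒I _ _ t)        = IsTerm⇒lc t
typable-lc (⇒I' _ _ t)       = IsTerm⇒lc t
typable-lc (⇒E _ _ _ t)      = IsTerm⇒lc t
typable-lc (⊓I D _)          = typable-lc D
typable-lc (er {M = M} j D)  = lc-lift j 0 M (typable-lc D)
typable-lc (⊑r D _ _)        = typable-lc D

module Realisability {r} (I : Interp r) where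
  open Interp I

  -- The two facts are proved
  -- together: membership of 𝓘(U → T) in 𝓜^[] is tested on a fresh argument
  -- variable of 𝒱₁.
  mutual
    neutral-T : ∀ T x → V₁ x → ∀ M → 𝓝 [] x M → ⟦ T ⟧T I M
    neutral-T (atom a) x x∈V₁ M nM = neut a x x∈V₁ M nM
    neutral-T (U ⇒ T) x x∈V₁ M (tM , sp) = tM , λ N N∈U J →
      neutral-T T x x∈V₁ (app M N)
        (app tM (proj₁ (⟦⟧⊆𝓜 U N N∈U)) (subst (_⪯ deg N) (sym (deg-spine sp)) ([]⪯ _)) J
        , sp · N)

    variable-U : ∀ {L} (U : UU L) x → V₁ x → ⟦ U ⟧ I (fvar x L)
    variable-U ⌊ T ⌋   x x∈V₁ = neutral-T T x x∈V₁ (fvar x []) (var x [] , hd)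
    variable-U (ω L)   x x∈V₁ = var x L , refl
    variable-U (U ⊓ V) x x∈V₁ = variable-U U x x∈V₁ , variable-U V x x∈V₁
    variable-U (ē i U) x x∈V₁ = fvar x _ , variable-U U x x∈V₁ , refl

    ⟦⟧T⊆𝓜 : ∀ T M → ⟦ T ⟧T I M → 𝓜^ [] M
    ⟦⟧T⊆𝓜 (atom a) M h = ⊆𝓜 a M h
    ⟦⟧T⊆𝓜 (_⇒_ {L} U T) M (tM , f) =
      tM , proj₂ (⟦⟧T⊆𝓜 T _ (f (fvar x L) (variable-U U x (fresh-V₁ (names M)))
                                       (joinable-fresh M x L (fresh-∉ (names M)))))
      where x = fresh (names M)

    ⟦⟧⊆𝓜 : ∀ {L} (U : UU L) M → ⟦ U ⟧ I M → 𝓜^ L M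
    ⟦⟧⊆𝓜 ⌊ T ⌋   M h = ⟦⟧T⊆𝓜 T M h
    ⟦⟧⊆𝓜 (ω L)   M h = h
    ⟦⟧⊆𝓜 (U ⊓ V) M (h , _) = ⟦⟧⊆𝓜 U M h
    ⟦⟧⊆𝓜 (ē i U) .(lift i M') (M' , h , refl) with ⟦⟧⊆𝓜 U M' h
    ... | tM' , dM' = IsTerm-lift i tM' , trans (deg-lift i M' (IsTerm⇒lc tM')) (cong (i ∷_) dM')

  _⊆_ : ∀ {L} → UU L → UU L → Set
  U ⊆ V = ∀ M → ⟦ U ⟧ I M → ⟦ V ⟧ I M

  -- The ē-equations rely on injectivity of
  -- lifting and on the decomposition 𝓜^{i::K} = (𝓜^K)^{+i}.
  mutual
    ≈⇒⊆ : ∀ {L} {U V : UU L} → U ≈ V → U ⊆ V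
    ≈⇒⊆ ≈refl         M h = h
    ≈⇒⊆ (≈sym e)      M h = ≈⇒⊇ e M h
    ≈⇒⊆ (≈trans e e') M h = ≈⇒⊆ e' M (≈⇒⊆ e M h)
    ≈⇒⊆ ⊓comm         M (a , b) = b , a
    ≈⇒⊆ ⊓assoc        M ((a , b) , c) = a , (b , c)
    ≈⇒⊆ ⊓idem         M (a , _) = a
    ≈⇒⊆ ē⊓            M (M' , (a , b) , e) = (M' , a , e) , (M' , b , e)
    ≈⇒⊆ ω⊓            M (_ , b) = b
    ≈⇒⊆ ēω            .(lift _ M') (M' , (tM' , dM') , refl) =
      IsTerm-lift _ tM' , trans (deg-lift _ M' (IsTerm⇒lc tM')) (cong (_ ∷_) dM')
    ≈⇒⊆ (⊓cong e e')  M (a , b) = ≈⇒⊆ e M a , ≈⇒⊆ e' M b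
    ≈⇒⊆ (ēcong e)     M (M' , h , eq) = M' , ≈⇒⊆ e M' h , eq
    ≈⇒⊆ (⇒cong e e')  M (tM , f) = tM , λ N N∈U J → ≈⇒⊆ e' _ (f N (≈⇒⊇ e N N∈U) J)

    ≈⇒⊇ : ∀ {L} {U V : UU L} → U ≈ V → V ⊆ U
    ≈⇒⊇ ≈refl         M h = h
    ≈⇒⊇ (≈sym e)      M h = ≈⇒⊆ e M h
    ≈⇒⊇ (≈trans e e') M h = ≈⇒⊇ e M (≈⇒⊇ e' M h)
    ≈⇒⊇ ⊓comm         M (a , b) = b , a
    ≈⇒⊇ ⊓assoc        M (a , (b , c)) = (a , b) , c
    ≈⇒⊇ ⊓idem         M a = a , a
    ≈⇒⊇ (ē⊓ {i = i} {V = V}) M ((M₁ , a , e₁) , (M₂ , b , e₂)) =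
      M₁ , (a , subst (⟦ V ⟧ I) (sym (lift-injective i M₁ M₂ (trans (sym e₁) e₂))) b) , e₁
    ≈⇒⊇ (ω⊓ {U = U})  M b = ⟦⟧⊆𝓜 U M b , b
    ≈⇒⊇ (ēω {i} {K})  M h = let (e , h') = 𝓜-unlift i K M h in unlift M , h' , e
    ≈⇒⊇ (⊓cong e e')  M (a , b) = ≈⇒⊇ e M a , ≈⇒⊇ e' M b
    ≈⇒⊇ (ēcong e)     M (M' , h , eq) = M' , ≈⇒⊇ e M' h , eq
    ≈⇒⊇ (⇒cong e e')  M (tM , f) = tM , λ N N∈U J → ≈⇒⊇ e' _ (f N (≈⇒⊆ e N N∈U) J)

  ⊑⇒⊆ : ∀ {L} {U V : UU L} → U ⊑ V → U ⊆ V
  ⊑⇒⊆ (⊑≈ e)         = ≈⇒⊆ e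
  ⊑⇒⊆ (⊑trans s s')  M h = ⊑⇒⊆ s' M (⊑⇒⊆ s M h)
  ⊑⇒⊆ ⊑⊓             M (a , _) = a
  ⊑⇒⊆ (⊑⊓mono s s')  M (a , b) = ⊑⇒⊆ s M a , ⊑⇒⊆ s' M b
  ⊑⇒⊆ (⊑⇒ s s')      M (tM , f) = tM , λ N N∈U J → ⊑⇒⊆ s' _ (f N (⊑⇒⊆ s N N∈U) J)
  ⊑⇒⊆ (⊑ē s)         M (M' , h , eq) = M' , ⊑⇒⊆ s M' h , eq

  -- 𝓘(T) is closed under head expansion: atoms by saturation, arrows because
  -- head reduction is compatible with application to an argument.
  head-expansion : ∀ T {X Y} → IsTerm X → HeadC X Y → ⟦ T ⟧T I Y → ⟦ T ⟧T I X
  head-expansion (atom a) {X} {Y} tX h Y∈a = sat a X Y tX (head⊆step r h ◅ ε) Y∈a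
  head-expansion (U ⇒ T) {X} {Y} tX h (tY , f) = tX , λ N N∈U J →
    head-expansion T (app tX (proj₁ (⟦⟧⊆𝓜 U N N∈U)) (dXN N) J) (happ h)
      (f N N∈U (λ x L K m n → J x L K (fv-head h m) n))
    where
    dXN : ∀ N → deg X ⪯ deg N
    dXN N = subst (_⪯ deg N)
              (sym (trans (deg-head (IsTerm⇒lc tX) h) (proj₂ (⟦⟧T⊆𝓜 (U ⇒ T) Y (tY , f)))))
              ([]⪯ _)

  RealisesAt : ∀ L → Maybe (UU L) → Maybe Tm → Set
  RealisesAt L (just V) (just N) = ⟦ V ⟧ I N
  RealisesAt L (just V) nothing  = ⊥
  RealisesAt L nothing  (just N) = 𝓜^ L N
  RealisesAt L nothing  nothing  = ⊤

  Realises : Env → Sub → Set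
  Realises Γ σ = ∀ x L → RealisesAt L (Γ x L) (σ x L)

  realises⇒well-degreed : ∀ {Γ σ} → Realises Γ σ → WellDegreed σ
  realises⇒well-degreed {Γ} {σ} R y K = at (Γ y K) (σ y K) (R y K)
    where
    at : ∀ mV mN → RealisesAt K mV mN → All (𝓜^ K) mN
    at (just V) (just N) h = just (⟦⟧⊆𝓜 V N h)
    at nothing  (just N) h = just h
    at _        nothing  _ = nothing

  realises-extend : ∀ {Γ σ x L} {U : UU L} {N} → Realises Γ σ → ⟦ U ⟧ I N →
                    Realises (extend Γ x L U) (extendS σ x L N)
  realises-extend {x = x} {L} R h y K with (y , K) ≟V (x , L)
  ... | yes refl = h
  ... | no _     = R y K

  realises-extend-ω : ∀ {Γ σ x L N} → Realises Γ σ → Γ x L ≡ nothing → 𝓜^ L N →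
                      Realises Γ (extendS σ x L N)
  realises-extend-ω {Γ} {x = x} {L} {N} R Γx≡ h y K with (y , K) ≟V (x , L)
  ... | yes refl = subst (λ m → RealisesAt L m (just N)) (sym Γx≡) h
  ... | no _     = R y K

  realises-⊓ˡ : ∀ {Γ₁ Γ₂ σ} → Realises (Γ₁ ⊓E Γ₂) σ → Realises Γ₁ σ
  realises-⊓ˡ {Γ₁} {Γ₂} {σ} R x L with Γ₁ x L | Γ₂ x L | σ x L | R x L
  ... | just _  | just _  | just _  | (h , _) = h
  ... | just _  | nothing | _       | h       = h
  ... | nothing | just V  | just N  | h       = ⟦⟧⊆𝓜 V N h
  ... | nothing | just _  | nothing | _       = tt
  ... | nothing | nothing | _       | h       = h

  realises-⊓ʳ : ∀ {Γ₁ Γ₂ σ} → Realises (Γ₁ ⊓E Γ₂) σ → Realises Γ₂ σ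
  realises-⊓ʳ {Γ₁} {Γ₂} {σ} R x L with Γ₁ x L | Γ₂ x L | σ x L | R x L
  ... | just _  | just _  | just _  | (_ , h) = h
  ... | just U  | nothing | just N  | h       = ⟦⟧⊆𝓜 U N h
  ... | nothing | just _  | _       | h       = h
  ... | nothing | nothing | _       | h       = h

  realises-⊑ : ∀ {Γ Γ' σ} → Γ' ⊑E Γ → Realises Γ' σ → Realises Γ σ
  realises-⊑ {Γ} {Γ'} {σ} Γ'⊑Γ R x L with Γ' x L | Γ x L | Γ'⊑Γ x L | σ x L | R x L
  ... | just _  | just _  | just s  | just N | h = ⊑⇒⊆ s N h
  ... | nothing | nothing | nothing | _      | h = h

  unliftS : ℕ → Sub → Sub
  unliftS j σ x L = Maybe.map unlift (σ x (j ∷ L))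

  ēE-at : ∀ j Γ x L → ēE j Γ x (j ∷ L) ≡ Maybe.map (ē j) (Γ x L)
  ēE-at j Γ x L with j ℕ.≟ j
  ... | yes refl = refl
  ... | no j≢j   = ⊥-elim (j≢j refl)

  realises-unlift : ∀ j {Γ σ} → Realises (ēE j Γ) σ → Realises Γ (unliftS j σ)
  realises-unlift j {Γ} {σ} R x L =
    at (Γ x L) (σ x (j ∷ L))
       (subst (λ m → RealisesAt (j ∷ L) m (σ x (j ∷ L))) (ēE-at j Γ x L) (R x (j ∷ L)))
    where
    at : ∀ mV mN → RealisesAt (j ∷ L) (Maybe.map (ē j) mV) mN → RealisesAt L mV (Maybe.map unlift mN)
    at (just V) (just N) (N' , h , refl) = subst (⟦ V ⟧ I) (sym (unlift-lift j N')) h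
    at nothing  (just N) h = proj₂ (𝓜-unlift j L N h)
    at nothing  nothing  _ = tt

  subst-lift : ∀ j {σ} → WellDegreed σ → ∀ M →
               substS σ (lift j M) ≡ lift j (substS (unliftS j σ) M)
  subst-lift j {σ} g (fvar y K) with σ y (j ∷ K) | g y (j ∷ K)
  ... | just N  | just h = proj₁ (𝓜-unlift j K N h)
  ... | nothing | _      = refl
  subst-lift j g (bvar i)  = refl
  subst-lift j g (app M N) = cong₂ app (subst-lift j g M) (subst-lift j g N)
  subst-lift j g (lam L M) = cong (lam (j ∷ L)) (subst-lift j g M)

  -- The application σ(λx^L.M) N is a
  -- term whose head reduct is (σ, x^L ↦ N)(M), so head expansion applies.
  realises-abs : ∀ {L} (U : UU L) T σ x M → WellDegreed σ → lcAt 0 M →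
                 IsTerm (substS σ (ƛ x L M)) →
                 (∀ N → ⟦ U ⟧ I N → IsTerm (substS (extendS σ x L N) M) →
                        ⟦ T ⟧T I (substS (extendS σ x L N) M)) →
                 ⟦ ⌊ U ⇒ T ⌋ ⟧ I (substS σ (ƛ x L M))
  realises-abs {L} U T σ x M g lcM tS@(lam y y∉B tyB dyB) body = tS , applied
    where
    B : Tm
    B = substS σ (closeAt 0 x L M)
    applied : ∀ N → ⟦ U ⟧ I N → Joinable (lam L B) N → ⟦ T ⟧T I (app (lam L B) N)
    applied N N∈U J = head-expansion T (app tS tN dλN J) (hbase dN)
                        (subst (⟦ T ⟧T I) (sym reduct≡) (body N N∈U tReduct))
      where
      tN : IsTerm N
      tN = proj₁ (⟦⟧⊆𝓜 U N N∈U)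
      dN : deg N ≡ L
      dN = proj₂ (⟦⟧⊆𝓜 U N N∈U)
      reduct≡ : open0 N B ≡ substS (extendS σ x L N) M
      reduct≡ = open-subst-close g 0 x L N M lcM
      jo : JoinableOutside (open0 (fvar y L) B) y L N
      jo w K K' m w≢y n with fv-open⁻ 0 (fvar y L) B m
      ... | inj₁ mB       = J w K K' mB n
      ... | inj₂ (here e) = ⊥-elim (w≢y e)
      tReduct : IsTerm (substS (extendS σ x L N) M)
      tReduct = subst IsTerm (trans (sym (open-via-single 0 y L N B (y∉B ∘ names⁺ B))) reduct≡)
                  (single-subst-term tyB y L N tN dN jo)
      dλN : deg (lam L B) ⪯ deg N
      dλN = subst₂ _⪯_ (deg-open0 (fvar y L) B tt) (sym dN) dyB

  extend-self : ∀ Γ x L (U : UU L) → extend Γ x L U x L ≡ just U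
  extend-self Γ x L U with (x , L) ≟V (x , L)
  ... | yes refl = refl
  ... | no ≢     = ⊥-elim (≢ refl)

  soundness : ∀ {Γ M K} {U : UU K} → M ⦂⟨ Γ ⊢ U ⟩ → ∀ σ → Realises Γ σ →
              IsTerm (substS σ M) → ⟦ U ⟧ I (substS σ M)
  soundness (ax x T) σ R _ =
    at (σ x []) (subst (λ m → RealisesAt [] m (σ x [])) (extend-self emptyEnv x [] ⌊ T ⌋) (R x []))
    where
    at : ∀ mN → RealisesAt [] (just ⌊ T ⌋) mN → ⟦ T ⟧T I (fromMaybe (fvar x []) mN)
    at (just N) h = h
  soundness {Γ} (ωr M _) σ R tS = tS , deg-subst (realises⇒well-degreed {Γ} R) [] M
  soundness {Γ} (⇒I {M = M} {x} {L} {U} {T} _ D _) σ R tS =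
    realises-abs U T σ x M (realises⇒well-degreed {Γ} R) (typable-lc D) tS
      (λ N N∈U → soundness D (extendS σ x L N) (realises-extend {Γ} {σ} {U = U} R N∈U))
  soundness {Γ} (⇒I' {M = M} {x} {L} {T} D Γx≡ _) σ R tS =
    realises-abs (ω L) T σ x M (realises⇒well-degreed {Γ} R) (typable-lc D) tS
      (λ N N∈𝓜 → soundness D (extendS σ x L N) (realises-extend-ω {Γ} {σ} R Γx≡ N∈𝓜))
  soundness (⇒E {Γ₁} {Γ₂} D₁ D₂ _ _) σ R (app t₁ t₂ _ J) =
    proj₂ (soundness D₁ σ (realises-⊓ˡ {Γ₁} {Γ₂} R) t₁) _
          (soundness D₂ σ (realises-⊓ʳ {Γ₁} {Γ₂} R) t₂) J
  soundness (⊓I D₁ D₂) σ R tS = soundness D₁ σ R tS , soundness D₂ σ R tS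
  soundness (er {Γ} {M} j D) σ R tS =
    substS (unliftS j σ) M , soundness D (unliftS j σ) (realises-unlift j {Γ} R) tσM , σlift≡
    where
    σlift≡ : substS σ (lift j M) ≡ lift j (substS (unliftS j σ) M)
    σlift≡ = subst-lift j (realises⇒well-degreed {ēE j Γ} R) M
    tσM : IsTerm (substS (unliftS j σ) M)
    tσM = IsTerm-unlift j (subst IsTerm σlift≡ tS) _ refl
  soundness (⊑r {Γ} {Γ'} D U⊑U' Γ'⊑Γ) σ R tS =
    ⊑⇒⊆ U⊑U' _ (soundness D σ (realises-⊑ {Γ} {Γ'} Γ'⊑Γ R) tS)

substOf : ∀ {n} (xs : Fin n → ℕ) (Ls : Fin n → Index) (Ns : Fin n → Tm) → Sub
substOf xs Ls Ns x L = Maybe.map (Ns ∘ proj₁) (findIx xs Ls x L)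

substM≡substS : ∀ {n} (xs : Fin n → ℕ) (Ls : Fin n → Index) (Ns : Fin n → Tm) M →
                substM xs Ls Ns M ≡ substS (substOf xs Ls Ns) M
substM≡substS xs Ls Ns (fvar y K) with findIx xs Ls y K
... | just _  = refl
... | nothing = refl
substM≡substS xs Ls Ns (bvar i)  = refl
substM≡substS xs Ls Ns (app M N) = cong₂ app (substM≡substS xs Ls Ns M) (substM≡substS xs Ls Ns N)
substM≡substS xs Ls Ns (lam L M) = cong (lam L) (substM≡substS xs Ls Ns M)

realises-envOf : ∀ {r} (I : Interp r) {n} (xs : Fin n → ℕ) (Ls : Fin n → Index)
                 (Us : (j : Fin n) → UU (Ls j)) (Ns : Fin n → Tm) →
                 (∀ j → ⟦ Us j ⟧ I (Ns j)) →
                 Realisability.Realises I (envOf xs Ls Us) (substOf xs Ls Ns)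
realises-envOf I xs Ls Us Ns Ns∈Us x L with findIx xs Ls x L
... | just (j , _ , refl) = Ns∈Us j
... | nothing             = tt

-- Lemma 11: soundness for σ = (x_j^{L_j} ↦ N_j)_j; of the definedness
-- conditions on the substitution only the termhood of the result is used.
lemma11 : (r : Red) (n : ℕ) (xs : Fin n → ℕ) (Ls : Fin n → Index)
          (Us : (j : Fin n) → UU (Ls j)) → Distinct xs Ls →
          (M : Tm) {K : Index} (U : UU K) →
          M ⦂⟨ envOf xs Ls Us ⊢ U ⟩ →
          (I : Interp r) (Ns : Fin n → Tm) →
          (∀ j → ⟦ Us j ⟧ I (Ns j)) →
          SubstInM M xs Ls Ns →
          ⟦ U ⟧ I (substM xs Ls Ns M)
lemma11 r n xs Ls Us _ M U D I Ns Ns∈Us (_ , _ , _ , _ , tσM) =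
  subst (⟦ U ⟧ I) (sym σM≡)
    (Realisability.soundness I D (substOf xs Ls Ns) (realises-envOf I xs Ls Us Ns Ns∈Us)
                             (subst IsTerm σM≡ tσM))
  where
  σM≡ : substM xs Ls Ns M ≡ substS (substOf xs Ls Ns) M
  σM≡ = substM≡substS xs Ls Ns M
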